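{- Let $3 \le p \le q$ and let $D$ be a strong orientation of $K(3,p,q)$ with diameter two, with parts $V_1=\{x_1,x_2,x_3\}$, $V_2$ ($|V_2|=p$), $V_3$ ($|V_3|=q$). If $V_2 = V_2^A \cup V_2^B$ for two nonempty proper subsets $A$ and $B$ of $[3]=\{1,2,3\}$ with $|A| \ne |B|$, then $$q \le \max\left\{4 + 2\binom{p-1}{\lfloor \frac{p-1}{2} \rfloor},\ 2 + 4\binom{p-2}{\lfloor \frac{p-2}{2} \rfloor},\ \binom{p+1}{\lfloor \frac{p+1}{2} \rfloor} - 1\right\}.$$
   Context: $K(3,p,q)$ is the complete tripartite graph with parts $V_1=\{x_1,x_2,x_3\}$, $V_2$ of size $p$, $V_3$ of size $q$. A strong orientation is an orientation of all edges making the digraph strongly connected; its diameter is the maximum directed distance between ordered pairs of vertices. Write $u\to v$ if the edge $uv$ is oriented from $u$ to $v$. For $A \subseteq [3]$, let $N_D^A$ be the set of vertices $w$ such that $x_i \to w$ for all $i \in A$ and $w \to x_j$ for all $j \in [3]\setminus A$, and $V_2^A = V_2 \cap N_D^A$. -}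

module Defs where

open import Data.Nat using (ℕ)
open import Data.Fin using (Fin)
open import Data.Fin.Subset using (Subset; _∈_; _∉_)
open import Data.Sum using (_⊎_; inj₁; inj₂)
open import Data.Product using (_×_; ∃)
open import Relation.Nullary using (¬_)
open import Relation.Binary.PropositionalEquality using (_≡_)

Vtx : ℕ → ℕ → Set
Vtx p q = Fin 3 ⊎ (Fin p ⊎ Fin q)

part : ∀ {p q} → Vtx p q → Fin 3
part (inj₁ _)        = Fin.zero
part (inj₂ (inj₁ _)) = Fin.suc Fin.zero
part (inj₂ (inj₂ _)) = Fin.suc (Fin.suc Fin.zero)

x : ∀ {p q} → Fin 3 → Vtx p q
x i = inj₁ i

v2 : ∀ {p q} → Fin p → Vtx p q
v2 y = inj₂ (inj₁ y)

Adjacent : ∀ {p q} → Vtx p q → Vtx p q → Set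
Adjacent u v = ¬ (part u ≡ part v)

record Orientation (p q : ℕ) : Set₁ where
  field
    _⇒_      : Vtx p q → Vtx p q → Set
    onEdges  : ∀ u v → u ⇒ v → Adjacent u v
    total    : ∀ u v → Adjacent u v → (u ⇒ v) ⊎ (v ⇒ u)
    antisym  : ∀ u v → u ⇒ v → ¬ (v ⇒ u)

open Orientation public

Dist≤2 : ∀ {p q} (D : Orientation p q) → Vtx p q → Vtx p q → Set
Dist≤2 D u v = _⇒_ D u v ⊎ ∃ λ w → _⇒_ D u w × _⇒_ D w v

-- D is strongly connected and has diameter exactly two: every ordered pair of
-- distinct vertices is at distance ≤ 2 (hence D is strong), and some ordered
-- pair of distinct vertices is at distance exactly 2 (not at distance 1).
Diameter2 : ∀ {p q} → Orientation p q → Set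
Diameter2 D =
  (∀ u v → ¬ (u ≡ v) → Dist≤2 D u v) ×
  ∃ λ u → ∃ λ v → ¬ (u ≡ v) × ¬ (_⇒_ D u v)

-- N_D^A restricted to V2: vertices w ∈ V2 with x_i → w for i ∈ A and w → x_j for j ∉ A.
InV2 : ∀ {p q} (D : Orientation p q) → Subset 3 → Fin p → Set
InV2 D A y =
  (∀ i → i ∈ A → _⇒_ D (x i) (v2 y)) ×
  (∀ j → j ∉ A → _⇒_ D (v2 y) (x j))

NonemptyProper : Subset 3 → Set
NonemptyProper A = (∃ λ i → i ∈ A) × (∃ λ j → j ∉ A)

{-# OPTIONS --safe #-}
-- For w ∈ V3 let N₁ w ⊆ [3] and N₂ w ⊆ V2 record its out-neighbours, and for y ∈ V2 let
-- τ y = {i | x_i → y}. Diameter two makes the out-neighbourhoods of V3 an antichain and supplies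
-- paths of length two linking N₁, N₂ and τ. As |A| ≠ |B|, up to swapping we have A = {a} and
-- either B = [3] ∖ {a} or B = [3] ∖ {c} with c ≠ a.
-- If B = [3] ∖ {a}, group V3 by N₁ w. Within a group the N₂ w agree off V2ᴬ or off V2ᴮ and form
-- an antichain there, so by Sperner's theorem the groups ∅, [3], {a, b}, {a, c}, {b}, {c} have
-- at most 1, 1, C(k, ⌊k/2⌋), C(k, ⌊k/2⌋), C(m, ⌊m/2⌋), C(m, ⌊m/2⌋) members (k = |V2ᴬ|,
-- m = |V2ᴮ|), while {a} and {b, c} are empty unless all of V2 has one type, when q ≤ C(p, ⌊p/2⌋).
-- If B = [3] ∖ {c}, every w has a ∈ N₁ w ∌ c; listing V2ᴬ, then x_b, then V2ᴮ turns the
-- out-neighbourhoods into an antichain of subsets of a (p+1)-set containing no final segment.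
-- In a symmetric chain decomposition the final segments form the chain through ∅, so such an
-- antichain has fewer than C(p+1, ⌊(p+1)/2⌋) members.
module Submission where

open import Defs
open import Data.Nat using (ℕ; _≤_; _∸_; _+_; _*_; _⊔_; ⌊_/2⌋)
open import Data.Nat.Combinatorics using (_C_)
open import Data.Fin using (Fin)
open import Data.Fin.Subset using (Subset; ∣_∣)
open import Data.Sum using (_⊎_)
open import Relation.Nullary using (¬_)
open import Relation.Binary.PropositionalEquality using (_≡_)

open import Data.Bool.Base using (true; false; if_then_else_)
open import Data.Bool.Properties using () renaming (_≟_ to _≟ᵇ_)
open import Data.Fin using (zero; suc; toℕ; fromℕ<) renaming (_≟_ to _≟ᶠ_)
open import Data.Fin.Properties using (toℕ-fromℕ<; injective⇒≤)
open import Data.Fin.Subset using (inside; outside; _∈_; _∉_; _⊆_; ⊥; ⊤; ⁅_⁆; ∁)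
open import Data.Fin.Subset.Properties
  using ( _∈?_; nonempty?; ∉⊥; ∈⊤; x∈⁅x⁆; x∈⁅y⁆⇒x≡y; x≢y⇒x∉⁅y⁆; x∈p⇒x∉∁p; x∉p⇒x∈∁p; x∉∁p⇒x∈p
        ; x∈∁p⇒x∉p; out⊆; in⊆in; drop-∷-⊆; ⊆-reflexive; ⊆-antisym; p⊆q⇒∣p∣≤∣q∣; ∣p∣≤n
        ; ∣p∣≡n⇒p≡⊤; ∣⊥∣≡0; ∣⁅x⁆∣≡1; ∣∁p∣≡n∸∣p∣ )
open import Data.List using (List; []; _∷_; filter; length; lookup; allFin)
open import Data.List.Membership.Propositional.Properties using (∈-lookup; ∈-filter⁻)
open import Data.List.Properties using (length-tabulate)
import Data.List.Relation.Unary.All as All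
import Data.List.Relation.Unary.AllPairs as AllPairs
open import Data.List.Relation.Unary.Unique.Propositional using (Unique)
open import Data.List.Relation.Unary.Unique.Propositional.Properties using (filter⁺; allFin⁺)
open import Data.Nat using (suc; zero; _<_; z≤n; s≤s; s≤s⁻¹; _≤′_; ≤′-refl; ≤′-step; ⌈_/2⌉)
open import Data.Nat.Combinatorics using (nCk≡nC[n∸k]; nCn≡1; nC1≡n; nCk+nC[k+1]≡[n+1]C[k+1])
open import Data.Nat.Properties
open import Data.Nat.Solver using (module +-*-Solver)
open import Data.Product using (Σ-syntax; ∃-syntax; _×_; _,_; proj₁; proj₂)
open import Data.Sum using (inj₁; inj₂; [_,_]′; swap) renaming (map to map-⊎)
open import Data.Unit using (tt) renaming (⊤ to Unit)
open import Data.Vec using ([]; _∷_; _++_; here; there; tabulate)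
import Data.Vec as Vec
open import Data.Vec.Properties
  using (≡-dec; ∷-injectiveˡ; ∷-injectiveʳ; lookup∘tabulate; lookup⇒[]=; []=⇒lookup)
open import Data.Vec.Relation.Unary.All using ([]; _∷_)
open import Data.Vec.Relation.Unary.Unique.Propositional using ([]; _∷_) renaming (Unique to Uniqueᵛ)
open import Data.Vec.Relation.Unary.Unique.Propositional.Properties using ()
  renaming (lookup-injective to lookup-injectiveᵛ)
open import Function using (_∘_; Injective)
open import Level using (0ℓ)
open import Relation.Binary.PropositionalEquality
  using (_≢_; refl; sym; trans; cong; cong₂; subst; subst₂; ≢-sym; module ≡-Reasoning)
open import Relation.Nullary using (Dec; yes; no; does; contradiction)
open import Relation.Nullary.Decidable using (dec-true; dec-false)
open import Relation.Unary using (Pred; Decidable)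
open import Relation.Unary.Properties using (_∩?_; ∁?)

private
  variable
    k m n : ℕ

-- Binomial coefficients

nC0≡1 : ∀ n → n C 0 ≡ 1
nC0≡1 n = trans (nCk≡nC[n∸k] {n = n} z≤n) (nCn≡1 n)

nCk≤[1+n]Ck : ∀ n k → n C k ≤ suc n C k
nCk≤[1+n]Ck n zero    = ≤-reflexive (trans (nC0≡1 n) (sym (nC0≡1 (suc n))))
nCk≤[1+n]Ck n (suc k) = ≤-trans (m≤n+m (n C suc k) (n C k))
                                (≤-reflexive (nCk+nC[k+1]≡[n+1]C[k+1] n k))

nCk≤nC[1+k] : ∀ n k → suc (k + k) ≤ n → n C k ≤ n C suc k
nCk≤nC[1+k] (suc n) zero    _         = begin
  suc n C 0  ≡⟨ nC0≡1 (suc n) ⟩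
  1          ≤⟨ s≤s z≤n ⟩
  suc n      ≡⟨ nC1≡n (suc n) ⟨
  suc n C 1  ∎
  where open ≤-Reasoning
nCk≤nC[1+k] (suc n) (suc k) 2k+3≤1+n = begin
  suc n C suc k                ≡⟨ nCk+nC[k+1]≡[n+1]C[k+1] n k ⟨
  n C k + n C suc k            ≤⟨ +-monoˡ-≤ (n C suc k) nCk≤nC[2+k] ⟩
  n C suc (suc k) + n C suc k  ≡⟨ +-comm (n C suc (suc k)) (n C suc k) ⟩
  n C suc k + n C suc (suc k)  ≡⟨ nCk+nC[k+1]≡[n+1]C[k+1] n (suc k) ⟩
  suc n C suc (suc k)          ∎
  where
  open ≤-Reasoning
  2k+2≤n : suc k + suc k ≤ n
  2k+2≤n = s≤s⁻¹ 2k+3≤1+n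
  nCk≤nC[2+k] : n C k ≤ n C suc (suc k)
  nCk≤nC[2+k] with suc (suc k + suc k) ≤? n
  ... | yes 2k+3≤n = ≤-trans (nCk≤nC[1+k] n k 2k+1≤n) (nCk≤nC[1+k] n (suc k) 2k+3≤n)
    where
    2k+1≤n : suc (k + k) ≤ n
    2k+1≤n = ≤-trans (n≤1+n _) (subst (_≤ n) (cong suc (+-suc k k)) 2k+2≤n)
  ... | no 2k+3≰n = ≤-reflexive (begin-equality
    n C k                      ≡⟨ nCk≡nC[n∸k] (≤-trans (m≤m+n k _) (≤-reflexive (sym n≡k+[2+k]))) ⟩
    n C (n ∸ k)                ≡⟨ cong (λ j → n C (j ∸ k)) n≡k+[2+k] ⟩
    n C (k + suc (suc k) ∸ k)  ≡⟨ cong (n C_) (m+n∸m≡n k (suc (suc k))) ⟩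
    n C suc (suc k)            ∎)
    where
    n≡k+[2+k] : n ≡ k + suc (suc k)
    n≡k+[2+k] = trans (≤-antisym (s≤s⁻¹ (≰⇒> 2k+3≰n)) 2k+2≤n) (sym (+-suc k (suc k)))

central : ℕ → ℕ
central n = n C ⌊ n /2⌋

data Parity : ℕ → Set where
  even : ∀ j → Parity (j + j)
  odd  : ∀ j → Parity (suc (j + j))

parity : ∀ n → Parity n
parity zero = even 0
parity (suc n) with parity n
... | even j = odd j
... | odd j  = subst Parity (cong suc (+-suc j j)) (even (suc j))

central[2+2j]≡2*central[1+2j] : ∀ j → central (suc (suc (j + j))) ≡ 2 * central (suc (j + j))
central[2+2j]≡2*central[1+2j] j = begin
  suc O C ⌊ suc O /2⌋          ≡⟨ cong (λ i → suc O C suc i) (sym (n≡⌊n+n/2⌋ j)) ⟩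
  suc O C suc j                ≡⟨ nCk+nC[k+1]≡[n+1]C[k+1] O j ⟨
  O C j + O C suc j            ≡⟨ cong (O C j +_) symmetric ⟩
  O C j + O C j                ≡⟨ cong (λ i → O C i + O C i) (n≡⌈n+n/2⌉ j) ⟩
  central O + central O        ≡⟨ cong (central O +_) (+-identityʳ _) ⟨
  2 * central O                ∎
  where
  open ≡-Reasoning
  O : ℕ
  O = suc (j + j)
  symmetric : O C suc j ≡ O C j
  symmetric = trans (nCk≡nC[n∸k] (s≤s (m≤n+m j j))) (cong (O C_) (m+n∸n≡m j j))

central≤central[1+n] : ∀ n → central n ≤ central (suc n)
central≤central[1+n] n with parity n
... | even j = subst₂ (λ i i′ → (j + j) C i ≤ suc (j + j) C i′)
                      (n≡⌊n+n/2⌋ j) (n≡⌈n+n/2⌉ j) (nCk≤[1+n]Ck (j + j) j)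
... | odd j  = ≤-trans (m≤m+n _ _) (≤-reflexive (sym (central[2+2j]≡2*central[1+2j] j)))

central[1+n]≤2*central : ∀ n → central (suc n) ≤ 2 * central n
central[1+n]≤2*central n with parity n
... | odd j        = ≤-reflexive (central[2+2j]≡2*central[1+2j] j)
... | even zero    = s≤s z≤n
... | even (suc i) = begin
  suc J C ⌊ suc J /2⌋    ≡⟨ cong (suc J C_) (sym (n≡⌈n+n/2⌉ (suc i))) ⟩
  suc J C suc i          ≡⟨ nCk+nC[k+1]≡[n+1]C[k+1] J i ⟨
  J C i + J C suc i      ≤⟨ +-monoˡ-≤ (J C suc i) (nCk≤nC[1+k] J i (s≤s (+-monoʳ-≤ i (n≤1+n i)))) ⟩
  J C suc i + J C suc i  ≡⟨ cong (λ i′ → J C i′ + J C i′) (n≡⌊n+n/2⌋ (suc i)) ⟩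
  central J + central J  ≡⟨ cong (central J +_) (+-identityʳ _) ⟨
  2 * central J          ∎
  where
  open ≤-Reasoning
  J : ℕ
  J = suc i + suc i

central-mono : m ≤ n → central m ≤ central n
central-mono m≤n = go (≤⇒≤′ m≤n)
  where
  go : ∀ {n} → m ≤′ n → central m ≤ central n
  go ≤′-refl            = ≤-refl
  go (≤′-step {n} m≤′n) = ≤-trans (go m≤′n) (central≤central[1+n] n)

lookup-injective : ∀ {A : Set} {xs : List A} → Unique xs → Injective _≡_ _≡_ (lookup xs)
lookup-injective (_    AllPairs.∷ _)      {zero}  {zero}  _ = refl
lookup-injective (x∉xs AllPairs.∷ _)      {zero}  {suc j} e =
  contradiction e (All.lookup x∉xs (∈-lookup j))
lookup-injective (x∉xs AllPairs.∷ _)      {suc i} {zero}  e =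
  contradiction (sym e) (All.lookup x∉xs (∈-lookup i))
lookup-injective (_    AllPairs.∷ unique) {suc i} {suc j} e = cong suc (lookup-injective unique e)

length-split : ∀ {A : Set} {Q : Pred A 0ℓ} (Q? : Decidable Q) xs →
               length xs ≤ length (filter Q? xs) + length (filter (∁? Q?) xs)
length-split Q? []       = z≤n
length-split Q? (x ∷ xs) with ih ← length-split Q? xs | does (Q? x)
... | true  = s≤s ih
... | false = ≤-trans (s≤s ih) (≤-reflexive (sym (+-suc _ _)))

length-filter-split : ∀ {A : Set} {P Q : Pred A 0ℓ} (P? : Decidable P) (Q? : Decidable Q) xs →
  length (filter P? xs) ≤ length (filter (P? ∩? Q?) xs) + length (filter (P? ∩? ∁? Q?) xs)
length-filter-split P? Q? []       = z≤n
length-filter-split P? Q? (x ∷ xs) with ih ← length-filter-split P? Q? xs | does (P? x) | does (Q? x)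
... | false | _     = ih
... | true  | true  = s≤s ih
... | true  | false = ≤-trans (s≤s ih) (≤-reflexive (sym (+-suc _ _)))

head-⊆ : ∀ {x y} {p q : Subset n} → x ∷ p ⊆ y ∷ q → x ≡ inside → y ≡ inside
head-⊆ x∷p⊆y∷q refl with x∷p⊆y∷q here
... | here = refl

∷⊆∷ : ∀ {x y} {p q : Subset n} → (x ≡ inside → y ≡ inside) → p ⊆ q → x ∷ p ⊆ y ∷ q
∷⊆∷ {x = outside} _     p⊆q = out⊆ p⊆q
∷⊆∷ {x = inside}  x⇒y p⊆q rewrite x⇒y refl = in⊆in p⊆q

++-⊆⁻ : ∀ (xs xs′ : Subset m) {ys ys′ : Subset n} → xs ++ ys ⊆ xs′ ++ ys′ → xs ⊆ xs′ × ys ⊆ ys′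
++-⊆⁻ []       []         ys⊆ys′ = (λ ()) , ys⊆ys′
++-⊆⁻ (x ∷ xs) (x′ ∷ xs′) x∷xs++ys⊆ =
  let xs⊆xs′ , ys⊆ys′ = ++-⊆⁻ xs xs′ (drop-∷-⊆ x∷xs++ys⊆) in ∷⊆∷ (head-⊆ x∷xs++ys⊆) xs⊆xs′ , ys⊆ys′

x∈p⇒1≤∣p∣ : ∀ {p : Subset n} {x} → x ∈ p → 1 ≤ ∣ p ∣
x∈p⇒1≤∣p∣ {x = x} x∈p = subst (_≤ _) (∣⁅x⁆∣≡1 x)
  (p⊆q⇒∣p∣≤∣q∣ (λ y∈⁅x⁆ → subst (_∈ _) (sym (x∈⁅y⁆⇒x≡y x y∈⁅x⁆)) x∈p))

⟦_⟧ : {P : Pred (Fin n) 0ℓ} → Decidable P → Subset n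
⟦ P? ⟧ = tabulate (does ∘ P?)

module _ {P : Pred (Fin n) 0ℓ} (P? : Decidable P) {i : Fin n} where

  ∈⟦⟧⁺ : P i → i ∈ ⟦ P? ⟧
  ∈⟦⟧⁺ Pi = lookup⇒[]= i _ (trans (lookup∘tabulate (does ∘ P?) i) (dec-true (P? i) Pi))

  ∈⟦⟧⁻ : i ∈ ⟦ P? ⟧ → P i
  ∈⟦⟧⁻ i∈ with P? i | trans (sym (lookup∘tabulate (does ∘ P?) i)) ([]=⇒lookup i∈)
  ... | yes Pi | _ = Pi

infixl 6 _↾_

_↾_ : Subset n → (S : Subset n) → Subset ∣ S ∣
[]      ↾ []            = []
(x ∷ p) ↾ (outside ∷ S) = p ↾ S
(x ∷ p) ↾ (inside ∷ S)  = x ∷ (p ↾ S)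

↾-⊆ : ∀ {p q S : Subset n} {y} → p ↾ S ⊆ q ↾ S → y ∈ S → y ∈ p → y ∈ q
↾-⊆ {p = _ ∷ _} {_ ∷ _} {inside ∷ _}  ↾⊆↾ here        here        with head-⊆ ↾⊆↾ refl
... | refl = here
↾-⊆ {p = _ ∷ _} {_ ∷ _} {inside ∷ _}  ↾⊆↾ (there y∈S) (there y∈p) = there (↾-⊆ (drop-∷-⊆ ↾⊆↾) y∈S y∈p)
↾-⊆ {p = _ ∷ _} {_ ∷ _} {outside ∷ _} ↾⊆↾ (there y∈S) (there y∈p) = there (↾-⊆ ↾⊆↾ y∈S y∈p)

⊆-from-↾ : ∀ {p q : Subset n} S → p ↾ S ⊆ q ↾ S → (∀ {y} → y ∉ S → y ∈ p → y ∈ q) → p ⊆ q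
⊆-from-↾ S p↾S⊆q↾S off-S {y} y∈p with y ∈? S
... | yes y∈S = ↾-⊆ p↾S⊆q↾S y∈S y∈p
... | no  y∉S = off-S y∉S y∈p

⊥↾S≡⊥ : ∀ (S : Subset n) → ⊥ ↾ S ≡ ⊥
⊥↾S≡⊥ []            = refl
⊥↾S≡⊥ (outside ∷ S) = ⊥↾S≡⊥ S
⊥↾S≡⊥ (inside ∷ S)  = cong (outside ∷_) (⊥↾S≡⊥ S)

⊤↾S≡⊤ : ∀ (S : Subset n) → ⊤ ↾ S ≡ ⊤
⊤↾S≡⊤ []            = refl
⊤↾S≡⊤ (outside ∷ S) = ⊤↾S≡⊤ S
⊤↾S≡⊤ (inside ∷ S)  = cong (inside ∷_) (⊤↾S≡⊤ S)

FinalSegment : Subset n → Set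
FinalSegment []            = Unit
FinalSegment (outside ∷ s) = FinalSegment s
FinalSegment (inside ∷ s)  = s ≡ ⊤

++-∷≡⊤⁻ : ∀ (xs : Subset m) {c} {ys : Subset n} → xs ++ c ∷ ys ≡ ⊤ → c ≡ inside × ys ≡ ⊤
++-∷≡⊤⁻ []       e = ∷-injectiveˡ e , ∷-injectiveʳ e
++-∷≡⊤⁻ (_ ∷ xs) e = ++-∷≡⊤⁻ xs (∷-injectiveʳ e)

FinalSegment-++-∷ : ∀ (xs : Subset m) c {ys : Subset n} → FinalSegment (xs ++ c ∷ ys) →
                    (c ≡ outside × xs ≡ ⊥) ⊎ (c ≡ inside × ys ≡ ⊤)
FinalSegment-++-∷ []             outside _   = inj₁ (refl , refl)
FinalSegment-++-∷ []             inside  fin = inj₂ (refl , fin)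
FinalSegment-++-∷ (outside ∷ xs) c       fin with FinalSegment-++-∷ xs c fin
... | inj₁ (c≡outside , xs≡⊥) = inj₁ (c≡outside , cong (outside ∷_) xs≡⊥)
... | inj₂ c≡inside×ys≡⊤      = inj₂ c≡inside×ys≡⊤
FinalSegment-++-∷ (inside ∷ xs)  c       fin = inj₂ (++-∷≡⊤⁻ xs fin)

-- A symmetric chain decomposition and Sperner's theorem

-- Each chain b ⊂ … ⊂ t′ ⊂ t of Subset n, where ∣ b ∣ + ∣ t ∣ ≡ n, yields the chains
-- outside ∷ b ⊂ … ⊂ outside ∷ t ⊂ inside ∷ t and inside ∷ b ⊂ … ⊂ inside ∷ t′ of Subset (suc n).
-- bottom s is the least element of the chain through s, so Top s says that s is its greatest one.
bottom : Subset n → Subset n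
bottom []                   = []
bottom (outside ∷ s)        = outside ∷ bottom s
bottom {suc n} (inside ∷ s) =
  (if does (∣ s ∣ + ∣ bottom s ∣ ≟ n) then outside else inside) ∷ bottom s

Top : Subset n → Set
Top {n} s = ∣ s ∣ + ∣ bottom s ∣ ≡ n

top? : (s : Subset n) → Dec (Top s)
top? {n} s = ∣ s ∣ + ∣ bottom s ∣ ≟ n

bottom-top : ∀ (s : Subset n) → Top s → bottom (inside ∷ s) ≡ outside ∷ bottom s
bottom-top s top = cong (λ b → (if b then outside else inside) ∷ bottom s) (dec-true (top? s) top)

bottom-¬top : ∀ (s : Subset n) → ¬ Top s → bottom (inside ∷ s) ≡ inside ∷ bottom s
bottom-¬top s ¬top = cong (λ b → (if b then outside else inside) ∷ bottom s) (dec-false (top? s) ¬top)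

∣bottom∣≤∣s∣ : ∀ (s : Subset n) → ∣ bottom s ∣ ≤ ∣ s ∣
∣bottom∣≤∣s∣ []            = z≤n
∣bottom∣≤∣s∣ (outside ∷ s) = ∣bottom∣≤∣s∣ s
∣bottom∣≤∣s∣ (inside ∷ s) with top? s
... | yes top  = ≤-trans (≤-reflexive (cong ∣_∣ (bottom-top s top))) (m≤n⇒m≤1+n (∣bottom∣≤∣s∣ s))
... | no  ¬top = ≤-trans (≤-reflexive (cong ∣_∣ (bottom-¬top s ¬top))) (s≤s (∣bottom∣≤∣s∣ s))

∣s∣+∣bottom∣≤n : ∀ (s : Subset n) → ∣ s ∣ + ∣ bottom s ∣ ≤ n
∣s∣+∣bottom∣≤n []            = z≤n
∣s∣+∣bottom∣≤n (outside ∷ s) = m≤n⇒m≤1+n (∣s∣+∣bottom∣≤n s)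
∣s∣+∣bottom∣≤n {suc n} (inside ∷ s) with top? s
... | yes top  = subst (λ b → suc ∣ s ∣ + ∣ b ∣ ≤ suc n) (sym (bottom-top s top)) (s≤s (≤-reflexive top))
... | no  ¬top = subst (λ b → suc ∣ s ∣ + ∣ b ∣ ≤ suc n) (sym (bottom-¬top s ¬top))
  (s≤s (≤-trans (≤-reflexive (+-suc ∣ s ∣ ∣ bottom s ∣)) (≤∧≢⇒< (∣s∣+∣bottom∣≤n s) ¬top)))

¬top⇒¬top-bottom : ∀ (s : Subset n) → bottom (bottom s) ≡ bottom s → ¬ Top s → ¬ Top (bottom s)
¬top⇒¬top-bottom s idem ¬top = <⇒≢ (begin-strict
  ∣ bottom s ∣ + ∣ bottom (bottom s) ∣  ≡⟨ cong (λ b → ∣ bottom s ∣ + ∣ b ∣) idem ⟩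
  ∣ bottom s ∣ + ∣ bottom s ∣           ≤⟨ +-monoˡ-≤ ∣ bottom s ∣ (∣bottom∣≤∣s∣ s) ⟩
  ∣ s ∣ + ∣ bottom s ∣                  <⟨ ≤∧≢⇒< (∣s∣+∣bottom∣≤n s) ¬top ⟩
  _                                     ∎)
  where open ≤-Reasoning

bottom-idem : ∀ (s : Subset n) → bottom (bottom s) ≡ bottom s
bottom-idem []            = refl
bottom-idem (outside ∷ s) = cong (outside ∷_) (bottom-idem s)
bottom-idem (inside ∷ s) with top? s
... | yes top  = begin
  bottom (bottom (inside ∷ s))  ≡⟨ cong bottom (bottom-top s top) ⟩
  outside ∷ bottom (bottom s)   ≡⟨ cong (outside ∷_) (bottom-idem s) ⟩
  outside ∷ bottom s            ≡⟨ bottom-top s top ⟨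
  bottom (inside ∷ s)           ∎
  where open ≡-Reasoning
... | no  ¬top = begin
  bottom (bottom (inside ∷ s))  ≡⟨ cong bottom (bottom-¬top s ¬top) ⟩
  bottom (inside ∷ bottom s)    ≡⟨ bottom-¬top (bottom s) (¬top⇒¬top-bottom s (bottom-idem s) ¬top) ⟩
  inside ∷ bottom (bottom s)    ≡⟨ cong (inside ∷_) (bottom-idem s) ⟩
  inside ∷ bottom s             ≡⟨ bottom-¬top s ¬top ⟨
  bottom (inside ∷ s)           ∎
  where open ≡-Reasoning

bottom≡⇒⊆ : ∀ (s t : Subset n) → bottom s ≡ bottom t → ∣ s ∣ ≤ ∣ t ∣ → s ⊆ t
bottom≡⇒⊆ []            []            _ _       = λ ()
bottom≡⇒⊆ (outside ∷ s) (outside ∷ t) e ∣s∣≤∣t∣ = out⊆ (bottom≡⇒⊆ s t (∷-injectiveʳ e) ∣s∣≤∣t∣)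
bottom≡⇒⊆ (inside ∷ s)  (inside ∷ t)  e ∣s∣≤∣t∣ = in⊆in (bottom≡⇒⊆ s t (∷-injectiveʳ e) (s≤s⁻¹ ∣s∣≤∣t∣))
bottom≡⇒⊆ (outside ∷ s) (inside ∷ t)  e ∣s∣≤∣t∣ with top? t
... | no  ¬top = contradiction (∷-injectiveˡ (trans e (bottom-¬top t ¬top))) λ ()
... | yes top  = out⊆ (bottom≡⇒⊆ s t bs≡bt (+-cancelʳ-≤ _ _ _ (begin
  ∣ s ∣ + ∣ bottom t ∣  ≡⟨ cong (λ b → ∣ s ∣ + ∣ b ∣) bs≡bt ⟨
  ∣ s ∣ + ∣ bottom s ∣  ≤⟨ ∣s∣+∣bottom∣≤n s ⟩
  _                     ≡⟨ top ⟨
  ∣ t ∣ + ∣ bottom t ∣  ∎)))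
  where
  open ≤-Reasoning
  bs≡bt : bottom s ≡ bottom t
  bs≡bt = ∷-injectiveʳ (trans e (bottom-top t top))
bottom≡⇒⊆ (inside ∷ s)  (outside ∷ t) e ∣s∣≤∣t∣ with top? s
... | no  ¬top = contradiction (∷-injectiveˡ (trans (sym (bottom-¬top s ¬top)) e)) λ ()
... | yes top  = contradiction ∣s∣≤∣t∣ (<⇒≱ (s≤s (+-cancelʳ-≤ _ _ _ (begin
  ∣ t ∣ + ∣ bottom s ∣  ≡⟨ cong (λ b → ∣ t ∣ + ∣ b ∣) bs≡bt ⟩
  ∣ t ∣ + ∣ bottom t ∣  ≤⟨ ∣s∣+∣bottom∣≤n t ⟩
  _                     ≡⟨ top ⟨
  ∣ s ∣ + ∣ bottom s ∣  ∎))))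
  where
  open ≤-Reasoning
  bs≡bt : bottom s ≡ bottom t
  bs≡bt = ∷-injectiveʳ (trans (sym (bottom-top s top)) e)

up : Subset n → Subset n
up []            = []
up (outside ∷ s) with top? s
... | yes _ = inside ∷ s
... | no  _ = outside ∷ up s
up (inside ∷ s)  = inside ∷ up s

up-on-chain : ∀ (s : Subset n) → ¬ Top s → bottom (up s) ≡ bottom s × ∣ up s ∣ ≡ suc ∣ s ∣
up-on-chain []            ¬top = contradiction refl ¬top
up-on-chain (outside ∷ s) _ with top? s
... | yes top  = bottom-top s top , refl
... | no  ¬top = let b , w = up-on-chain s ¬top in cong (outside ∷_) b , w
up-on-chain {suc n} (inside ∷ s) ¬top-inside∷s with top? s
... | yes top  =
  contradiction (subst (λ b → suc ∣ s ∣ + ∣ b ∣ ≡ suc n) (sym (bottom-top s top)) (cong suc top)) ¬top-inside∷s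
... | no  ¬top with up-on-chain s ¬top
...   | b , w =
  trans (bottom-¬top (up s) ¬top-up) (trans (cong (inside ∷_) b) (sym (bottom-¬top s ¬top))) , cong suc w
  where
  ¬top-up : ¬ Top (up s)
  ¬top-up top-up = ¬top-inside∷s (subst (λ c → suc ∣ s ∣ + ∣ c ∣ ≡ suc n) (sym (bottom-¬top s ¬top))
    (trans (+-suc (suc ∣ s ∣) ∣ bottom s ∣) (cong suc (subst₂ (λ a c → a + ∣ c ∣ ≡ n) w b top-up))))

climb : ℕ → Subset n → Subset n
climb zero    s = s
climb (suc j) s = climb j (up s)

climb-on-chain : ∀ j (s : Subset n) → ∣ s ∣ + j + ∣ bottom s ∣ ≤ n →
                 bottom (climb j s) ≡ bottom s × ∣ climb j s ∣ ≡ ∣ s ∣ + j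
climb-on-chain zero    s _ = refl , sym (+-identityʳ ∣ s ∣)
climb-on-chain {n} (suc j) s room =
  let b , w   = up-on-chain s ¬top
      b′ , w′ = climb-on-chain j (up s) (room′ b w)
  in trans b′ b , trans w′ (trans (cong (_+ j) w) (sym (+-suc ∣ s ∣ j)))
  where
  ¬top : ¬ Top s
  ¬top top = <⇒≱ (subst (_< ∣ s ∣ + suc j + ∣ bottom s ∣) top
                        (+-monoˡ-< ∣ bottom s ∣ (m<m+n ∣ s ∣ (s≤s z≤n)))) room
  room′ : bottom (up s) ≡ bottom s → ∣ up s ∣ ≡ suc ∣ s ∣ → ∣ up s ∣ + j + ∣ bottom (up s) ∣ ≤ n
  room′ b w = subst₂ (λ a c → a + j + ∣ c ∣ ≤ n) (sym w) (sym b)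
                     (subst (λ a → a + ∣ bottom s ∣ ≤ n) (+-suc ∣ s ∣ j) room)

middle : Subset n → Subset n
middle {n} s = climb (⌊ n /2⌋ ∸ ∣ bottom s ∣) (bottom s)

middle-on-chain : ∀ (s : Subset n) → bottom (middle s) ≡ bottom s × ∣ middle s ∣ ≡ ⌊ n /2⌋
middle-on-chain {n} s =
  let b , w = climb-on-chain (⌊ n /2⌋ ∸ β) (bottom s) room in
  trans b (bottom-idem s) , trans w (m+[n∸m]≡n β≤⌊n/2⌋)
  where
  open ≤-Reasoning
  β : ℕ
  β = ∣ bottom s ∣
  β≤⌊n/2⌋ : β ≤ ⌊ n /2⌋
  β≤⌊n/2⌋ = subst (_≤ ⌊ n /2⌋) (sym (n≡⌊n+n/2⌋ β))
    (⌊n/2⌋-mono (≤-trans (+-monoˡ-≤ β (∣bottom∣≤∣s∣ s)) (∣s∣+∣bottom∣≤n s)))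
  room : β + (⌊ n /2⌋ ∸ β) + ∣ bottom (bottom s) ∣ ≤ n
  room = begin
    β + (⌊ n /2⌋ ∸ β) + ∣ bottom (bottom s) ∣  ≡⟨ cong₂ (λ a c → a + ∣ c ∣) (m+[n∸m]≡n β≤⌊n/2⌋)
                                                                           (bottom-idem s) ⟩
    ⌊ n /2⌋ + β                                ≤⟨ +-monoʳ-≤ ⌊ n /2⌋ (≤-trans β≤⌊n/2⌋ (⌊n/2⌋≤⌈n/2⌉ n)) ⟩
    ⌊ n /2⌋ + ⌈ n /2⌉                          ≡⟨ ⌊n/2⌋+⌈n/2⌉≡n n ⟩
    n                                          ∎

rank : Subset n → ℕ
rank []                   = 0
rank (outside ∷ s)        = rank s
rank {suc n} (inside ∷ s) = n C suc ∣ s ∣ + rank s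

rank< : ∀ (s : Subset n) → rank s < n C ∣ s ∣
rank< []                    = s≤s z≤n
rank< {suc n} (outside ∷ s) = ≤-trans (rank< s) (nCk≤[1+n]Ck n ∣ s ∣)
rank< {suc n} (inside ∷ s)  = begin-strict
  n C suc ∣ s ∣ + rank s     <⟨ +-monoʳ-< (n C suc ∣ s ∣) (rank< s) ⟩
  n C suc ∣ s ∣ + n C ∣ s ∣  ≡⟨ +-comm (n C suc ∣ s ∣) (n C ∣ s ∣) ⟩
  n C ∣ s ∣ + n C suc ∣ s ∣  ≡⟨ nCk+nC[k+1]≡[n+1]C[k+1] n ∣ s ∣ ⟩
  suc n C suc ∣ s ∣          ∎
  where open ≤-Reasoning

rank-injective : ∀ (s t : Subset n) → ∣ s ∣ ≡ ∣ t ∣ → rank s ≡ rank t → s ≡ t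
rank-injective []            []            _ _ = refl
rank-injective (outside ∷ s) (outside ∷ t) w r = cong (outside ∷_) (rank-injective s t w r)
rank-injective {suc n} (inside ∷ s) (inside ∷ t) w r =
  cong (inside ∷_) (rank-injective s t ∣s∣≡∣t∣ (+-cancelˡ-≡ (n C suc ∣ s ∣) (rank s) (rank t)
    (trans r (cong (λ i → n C suc i + rank t) (sym ∣s∣≡∣t∣)))))
  where
  ∣s∣≡∣t∣ : ∣ s ∣ ≡ ∣ t ∣
  ∣s∣≡∣t∣ = suc-injective w
rank-injective {suc n} (outside ∷ s) (inside ∷ t) w r =
  contradiction (subst (λ i → rank s < n C i) w (rank< s))
                (≤⇒≯ (≤-trans (m≤m+n _ _) (≤-reflexive (sym r))))
rank-injective {suc n} (inside ∷ s) (outside ∷ t) w r =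
  contradiction (subst (λ i → rank t < n C i) (sym w) (rank< t))
                (≤⇒≯ (≤-trans (m≤m+n _ _) (≤-reflexive r)))

chainIndex : Subset n → Fin (central n)
chainIndex {n} s =
  fromℕ< (subst (λ i → rank (middle s) < n C i) (proj₂ (middle-on-chain s)) (rank< (middle s)))

chainIndex-injective : ∀ (s t : Subset n) → chainIndex s ≡ chainIndex t → bottom s ≡ bottom t
chainIndex-injective s t e = begin
  bottom s           ≡⟨ proj₁ (middle-on-chain s) ⟨
  bottom (middle s)  ≡⟨ cong bottom middle-s≡middle-t ⟩
  bottom (middle t)  ≡⟨ proj₁ (middle-on-chain t) ⟩
  bottom t           ∎
  where
  open ≡-Reasoning
  middle-s≡middle-t : middle s ≡ middle t
  middle-s≡middle-t = rank-injective (middle s) (middle t)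
    (trans (proj₂ (middle-on-chain s)) (sym (proj₂ (middle-on-chain t))))
    (trans (sym (toℕ-fromℕ< _)) (trans (cong toℕ e) (toℕ-fromℕ< _)))

bottom-⊥ : bottom (⊥ {n}) ≡ ⊥
bottom-⊥ {zero}  = refl
bottom-⊥ {suc n} = cong (outside ∷_) bottom-⊥

bottom≡⊥⇒FinalSegment : ∀ (s : Subset n) → bottom s ≡ ⊥ → FinalSegment s
bottom≡⊥⇒FinalSegment []            _ = tt
bottom≡⊥⇒FinalSegment (outside ∷ s) e = bottom≡⊥⇒FinalSegment s (∷-injectiveʳ e)
bottom≡⊥⇒FinalSegment {suc n} (inside ∷ s) e with top? s
... | no  ¬top = contradiction (∷-injectiveˡ (trans (sym (bottom-¬top s ¬top)) e)) λ ()
... | yes top  = ∣p∣≡n⇒p≡⊤ (begin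
  ∣ s ∣                 ≡⟨ +-identityʳ ∣ s ∣ ⟨
  ∣ s ∣ + 0             ≡⟨ cong (∣ s ∣ +_) (∣⊥∣≡0 n) ⟨
  ∣ s ∣ + ∣ ⊥ {n} ∣      ≡⟨ cong (λ b → ∣ s ∣ + ∣ b ∣) (∷-injectiveʳ (trans (sym (bottom-top s top)) e)) ⟨
  ∣ s ∣ + ∣ bottom s ∣  ≡⟨ top ⟩
  n                     ∎)
  where open ≡-Reasoning

module _ {k n : ℕ} (f : Fin k → Subset n) (antichain : ∀ {i j} → f i ⊆ f j → i ≡ j) where

  same-chain⇒≡ : ∀ {i j} → bottom (f i) ≡ bottom (f j) → i ≡ j
  same-chain⇒≡ {i} {j} e with ≤-total ∣ f i ∣ ∣ f j ∣
  ... | inj₁ ∣fi∣≤∣fj∣ = antichain (bottom≡⇒⊆ (f i) (f j) e ∣fi∣≤∣fj∣)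
  ... | inj₂ ∣fj∣≤∣fi∣ = sym (antichain (bottom≡⇒⊆ (f j) (f i) (sym e) ∣fj∣≤∣fi∣))

  sperner : k ≤ central n
  sperner = injective⇒≤ (λ {i} {j} e → same-chain⇒≡ (chainIndex-injective (f i) (f j) e))

  sperner-without-final-segments : (∀ i → ¬ FinalSegment (f i)) → k < central n
  sperner-without-final-segments not-final = injective⇒≤ index-injective
    where
    index : Fin (suc k) → Fin (central n)
    index zero    = chainIndex (⊥ {n})
    index (suc i) = chainIndex (f i)
    off-chain-of-⊥ : ∀ i → chainIndex (⊥ {n}) ≢ chainIndex (f i)
    off-chain-of-⊥ i e = not-final i
      (bottom≡⊥⇒FinalSegment (f i) (trans (sym (chainIndex-injective ⊥ (f i) e)) (bottom-⊥ {n})))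
    index-injective : Injective _≡_ _≡_ index
    index-injective {zero}  {zero}  _ = refl
    index-injective {zero}  {suc j} e = contradiction e (off-chain-of-⊥ j)
    index-injective {suc i} {zero}  e = contradiction (sym e) (off-chain-of-⊥ i)
    index-injective {suc i} {suc j} e = cong suc (same-chain⇒≡ (chainIndex-injective (f i) (f j) e))

Listing : Fin 3 → Fin 3 → Fin 3 → Set
Listing a b c = ∀ i → i ≡ a ⊎ i ≡ b ⊎ i ≡ c

listing : ∀ {a b c : Fin 3} → a ≢ b → a ≢ c → b ≢ c → Listing a b c
listing {a} {b} {c} a≢b a≢c b≢c i with i ≟ᶠ a | i ≟ᶠ b | i ≟ᶠ c
... | yes i≡a | _       | _       = inj₁ i≡a
... | no _    | yes i≡b | _       = inj₂ (inj₁ i≡b)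
... | no _    | no _    | yes i≡c = inj₂ (inj₂ i≡c)
... | no i≢a  | no i≢b  | no i≢c  =
  contradiction (injective⇒≤ (λ {j} {k} → lookup-injectiveᵛ four-distinct j k)) λ { (s≤s (s≤s (s≤s ()))) }
  where
  four-distinct : Uniqueᵛ (a ∷ b ∷ c ∷ i ∷ [])
  four-distinct = (a≢b ∷ a≢c ∷ ≢-sym i≢a ∷ []) ∷ (b≢c ∷ ≢-sym i≢b ∷ []) ∷ (≢-sym i≢c ∷ []) ∷ [] ∷ []

others : ∀ (a : Fin 3) → Σ[ b ∈ Fin 3 ] Σ[ c ∈ Fin 3 ] a ≢ b × a ≢ c × b ≢ c
others zero             = suc zero , suc (suc zero) , (λ ()) , (λ ()) , (λ ())
others (suc zero)       = zero , suc (suc zero) , (λ ()) , (λ ()) , (λ ())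
others (suc (suc zero)) = zero , suc zero , (λ ()) , (λ ()) , (λ ())

third : ∀ {a c : Fin 3} → a ≢ c → Σ[ b ∈ Fin 3 ] a ≢ b × b ≢ c
third {a} {c} a≢c with others a
... | b , b′ , a≢b , a≢b′ , b≢b′ with listing a≢b a≢b′ b≢b′ c
...   | inj₁ c≡a         = contradiction (sym c≡a) a≢c
...   | inj₂ (inj₁ refl) = b′ , a≢b′ , ≢-sym b≢b′
...   | inj₂ (inj₂ refl) = b , a≢b , b≢b′

⊆-by-listing : ∀ {a b c} {X Y : Subset 3} → Listing a b c →
               (a ∈ X → a ∈ Y) → (b ∈ X → b ∈ Y) → (c ∈ X → c ∈ Y) → X ⊆ Y
⊆-by-listing abc a∈ b∈ c∈ {i} i∈X with abc i
... | inj₁ refl        = a∈ i∈X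
... | inj₂ (inj₁ refl) = b∈ i∈X
... | inj₂ (inj₂ refl) = c∈ i∈X

∈-by-listing : ∀ {a b c} {X : Subset 3} → Listing a b c → a ∈ X → b ∈ X → c ∈ X → ∀ i → i ∈ X
∈-by-listing abc a∈X b∈X c∈X i = ⊆-by-listing abc (λ _ → a∈X) (λ _ → b∈X) (λ _ → c∈X) (∈⊤ {x = i})

∉-by-listing : ∀ {a b c} {X : Subset 3} → Listing a b c → a ∉ X → b ∉ X → c ∉ X → ∀ i → i ∉ X
∉-by-listing abc a∉X b∉X c∉X i with abc i
... | inj₁ refl        = a∉X
... | inj₂ (inj₁ refl) = b∉X
... | inj₂ (inj₂ refl) = c∉X

x≢y⇒x∈∁⁅y⁆ : ∀ {x y : Fin n} → x ≢ y → x ∈ ∁ ⁅ y ⁆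
x≢y⇒x∈∁⁅y⁆ = x∉p⇒x∈∁p ∘ x≢y⇒x∉⁅y⁆

x∈∁⁅y⁆⇒x≢y : ∀ {x y : Fin n} → x ∈ ∁ ⁅ y ⁆ → x ≢ y
x∈∁⁅y⁆⇒x≢y {y = y} x∈∁⁅y⁆ refl = x∈p⇒x∉∁p (x∈⁅x⁆ y) x∈∁⁅y⁆

∣∁⁅x⁆∣≡2 : ∀ (x : Fin 3) → ∣ ∁ ⁅ x ⁆ ∣ ≡ 2
∣∁⁅x⁆∣≡2 x = trans (∣∁p∣≡n∸∣p∣ ⁅ x ⁆) (cong (3 ∸_) (∣⁅x⁆∣≡1 x))

singleton-or-cosingleton : ∀ {A : Subset 3} → NonemptyProper A → (∃[ a ] A ≡ ⁅ a ⁆) ⊎ (∃[ c ] A ≡ ∁ ⁅ c ⁆)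
singleton-or-cosingleton {outside ∷ outside ∷ outside ∷ []} ((_ , i∈A) , _) = contradiction i∈A ∉⊥
singleton-or-cosingleton {inside  ∷ outside ∷ outside ∷ []} _ = inj₁ (zero , refl)
singleton-or-cosingleton {outside ∷ inside  ∷ outside ∷ []} _ = inj₁ (suc zero , refl)
singleton-or-cosingleton {outside ∷ outside ∷ inside  ∷ []} _ = inj₁ (suc (suc zero) , refl)
singleton-or-cosingleton {outside ∷ inside  ∷ inside  ∷ []} _ = inj₂ (zero , refl)
singleton-or-cosingleton {inside  ∷ outside ∷ inside  ∷ []} _ = inj₂ (suc zero , refl)
singleton-or-cosingleton {inside  ∷ inside  ∷ outside ∷ []} _ = inj₂ (suc (suc zero) , refl)
singleton-or-cosingleton {inside  ∷ inside  ∷ inside  ∷ []} (_ , (_ , j∉A)) = contradiction ∈⊤ j∉A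

-- Arithmetic of the bound

bound : ℕ → ℕ
bound p = ((4 + 2 * central (p ∸ 1)) ⊔ (2 + 4 * central (p ∸ 2))) ⊔ (central (p + 1) ∸ 1)

module _ (p : ℕ) {x : ℕ} where

  ≤bound₁ : x ≤ 4 + 2 * central (p ∸ 1) → x ≤ bound p
  ≤bound₁ x≤ = ≤-trans x≤ (≤-trans (m≤m⊔n (4 + 2 * central (p ∸ 1)) (2 + 4 * central (p ∸ 2)))
                                   (m≤m⊔n _ (central (p + 1) ∸ 1)))

  ≤bound₂ : x ≤ 2 + 4 * central (p ∸ 2) → x ≤ bound p
  ≤bound₂ x≤ = ≤-trans x≤ (≤-trans (m≤n⊔m (4 + 2 * central (p ∸ 1)) (2 + 4 * central (p ∸ 2)))
                                   (m≤m⊔n _ (central (p + 1) ∸ 1)))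

  ≤bound₃ : x ≤ central (p + 1) ∸ 1 → x ≤ bound p
  ≤bound₃ x≤ = ≤-trans x≤ (m≤n⊔m ((4 + 2 * central (p ∸ 1)) ⊔ (2 + 4 * central (p ∸ 2)))
                                 (central (p + 1) ∸ 1))

central≤bound : ∀ {p} → 2 ≤ p → central p ≤ bound p
central≤bound {suc zero}    (s≤s ())
central≤bound {suc (suc r)} _ = ≤bound₂ (2 + r) (begin
  central (2 + r)      ≤⟨ central[1+n]≤2*central (1 + r) ⟩
  2 * central (1 + r)  ≤⟨ *-monoʳ-≤ 2 (central[1+n]≤2*central r) ⟩
  2 * (2 * central r)  ≡⟨ *-assoc 2 2 (central r) ⟨
  4 * central r        ≤⟨ m≤n+m (4 * central r) 2 ⟩
  2 + 4 * central r    ∎)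
  where open ≤-Reasoning

<central[1+p]⇒≤bound : ∀ {p q} → q < central (suc p) → q ≤ bound p
<central[1+p]⇒≤bound {p} {q} q<c =
  ≤bound₃ p (subst (λ n → q ≤ central n ∸ 1) (+-comm 1 p) (∸-monoˡ-≤ 1 q<c))

two-sides≤bound : ∀ k m → 1 ≤ k → 1 ≤ m → 2 + 2 * (central k + central m) ≤ bound (k + m)
two-sides≤bound (suc zero) m _ _ =
  ≤bound₁ (1 + m) (≤-reflexive (cong (2 +_) (*-distribˡ-+ 2 1 (central m))))
two-sides≤bound (suc (suc k)) (suc zero) _ _ =
  subst₂ (λ c n → 2 + 2 * c ≤ bound n) (+-comm 1 (central (2 + k))) (+-comm 1 (2 + k))
         (two-sides≤bound 1 (2 + k) (s≤s z≤n) (s≤s z≤n))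
two-sides≤bound (suc (suc k)) (suc (suc m)) _ _ = ≤bound₂ (2 + k + (2 + m)) (begin
  2 + 2 * (central (2 + k) + central (2 + m))  ≤⟨ +-monoʳ-≤ 2 (*-monoʳ-≤ 2 (+-mono-≤ (central-mono k≤)
                                                                                    (central-mono m≤))) ⟩
  2 + 2 * (c + c)                              ≡⟨ cong (2 +_) (trans (*-distribˡ-+ 2 c c)
                                                                     (sym (*-distribʳ-+ c 2 2))) ⟩
  2 + 4 * c                                    ∎)
  where
  open ≤-Reasoning
  c : ℕ
  c = central (k + (2 + m))
  k≤ : 2 + k ≤ k + (2 + m)
  k≤ = begin
    2 + k              ≤⟨ s≤s (s≤s (m≤m+n k m)) ⟩
    2 + (k + m)        ≡⟨ cong suc (+-suc k m) ⟨
    1 + (k + (1 + m))  ≡⟨ +-suc k (suc m) ⟨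
    k + (2 + m)        ∎
  m≤ : 2 + m ≤ k + (2 + m)
  m≤ = m≤n+m (2 + m) k

-- Out-neighbourhoods of V3 in an orientation of diameter two

-- N₁ w and N₂ w are the out-neighbourhoods in V1 and V2 of the vertex w of V3, τ y = {i | x i → y};
-- the other fields are the paths of length two, out of and into V3, that diameter two provides.
record Profile (p q : ℕ) : Set where
  field
    τ  : Fin p → Subset 3
    N₁ : Fin q → Subset 3
    N₂ : Fin q → Subset p
    to-V2     : ∀ {w y} → y ∉ N₂ w → ∃[ i ] i ∈ N₁ w × i ∈ τ y
    from-V2   : ∀ {w y} → y ∈ N₂ w → ∃[ i ] i ∉ N₁ w × i ∉ τ y
    to-V1     : ∀ {w i} → i ∉ N₁ w → ∃[ y ] y ∈ N₂ w × i ∉ τ y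
    from-V1   : ∀ {w i} → i ∈ N₁ w → ∃[ y ] y ∉ N₂ w × i ∈ τ y
    antichain : ∀ {w w′} → N₁ w ⊆ N₁ w′ → N₂ w ⊆ N₂ w′ → w ≡ w′

module _ {p q : ℕ} (D : Orientation p q) (diam : ∀ u v → ¬ (u ≡ v) → Dist≤2 D u v) where

  private
    infix 4 _⟶_
    _⟶_ : Vtx p q → Vtx p q → Set
    _⟶_ = _⇒_ D

    v3 : Fin q → Vtx p q
    v3 w = inj₂ (inj₂ w)

    arc? : ∀ u v → Adjacent u v → Dec (u ⟶ v)
    arc? u v adj with total D u v adj
    ... | inj₁ u⟶v = yes u⟶v
    ... | inj₂ v⟶u = no (antisym D v u v⟶u)

    τ? : ∀ y → Decidable (λ i → x i ⟶ v2 y)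
    τ? y i = arc? (x i) (v2 y) λ ()

    N₁? : ∀ w → Decidable (λ i → v3 w ⟶ x i)
    N₁? w i = arc? (v3 w) (x i) λ ()

    N₂? : ∀ w → Decidable (λ y → v3 w ⟶ v2 y)
    N₂? w y = arc? (v3 w) (v2 y) λ ()

    same-part : ∀ {u v} → part u ≡ part v → ¬ (u ⟶ v)
    same-part eq u⟶v = onEdges D _ _ u⟶v eq

    asym : ∀ {u v} → u ⟶ v → ¬ (v ⟶ u)
    asym = antisym D _ _

  profile : Profile p q
  profile = record
    { τ         = λ y → ⟦ τ? y ⟧
    ; N₁        = λ w → ⟦ N₁? w ⟧
    ; N₂        = λ w → ⟦ N₂? w ⟧
    ; to-V2     = to-V2
    ; from-V2   = from-V2
    ; to-V1     = to-V1
    ; from-V1   = from-V1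
    ; antichain = antichain
    }
    where
    to-V2 : ∀ {w y} → y ∉ ⟦ N₂? w ⟧ → ∃[ i ] i ∈ ⟦ N₁? w ⟧ × i ∈ ⟦ τ? y ⟧
    to-V2 {w} {y} y∉N₂ with diam (v3 w) (v2 y) (λ ())
    ... | inj₁ w⟶y                         = contradiction (∈⟦⟧⁺ (N₂? w) w⟶y) y∉N₂
    ... | inj₂ (inj₁ i , w⟶xi , xi⟶y)      = i , ∈⟦⟧⁺ (N₁? w) w⟶xi , ∈⟦⟧⁺ (τ? y) xi⟶y
    ... | inj₂ (inj₂ (inj₁ _) , _ , z⟶y)   = contradiction z⟶y (same-part refl)
    ... | inj₂ (inj₂ (inj₂ _) , w⟶z , _)   = contradiction w⟶z (same-part refl)

    from-V2 : ∀ {w y} → y ∈ ⟦ N₂? w ⟧ → ∃[ i ] i ∉ ⟦ N₁? w ⟧ × i ∉ ⟦ τ? y ⟧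
    from-V2 {w} {y} y∈N₂ with diam (v2 y) (v3 w) (λ ())
    ... | inj₁ y⟶w                         = contradiction y⟶w (asym (∈⟦⟧⁻ (N₂? w) y∈N₂))
    ... | inj₂ (inj₁ i , y⟶xi , xi⟶w)      =
      i , (λ i∈N₁ → asym (∈⟦⟧⁻ (N₁? w) i∈N₁) xi⟶w) , (λ i∈τ → asym (∈⟦⟧⁻ (τ? y) i∈τ) y⟶xi)
    ... | inj₂ (inj₂ (inj₁ _) , y⟶z , _)   = contradiction y⟶z (same-part refl)
    ... | inj₂ (inj₂ (inj₂ _) , _ , z⟶w)   = contradiction z⟶w (same-part refl)

    to-V1 : ∀ {w i} → i ∉ ⟦ N₁? w ⟧ → ∃[ y ] y ∈ ⟦ N₂? w ⟧ × i ∉ ⟦ τ? y ⟧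
    to-V1 {w} {i} i∉N₁ with diam (v3 w) (x i) (λ ())
    ... | inj₁ w⟶xi                        = contradiction (∈⟦⟧⁺ (N₁? w) w⟶xi) i∉N₁
    ... | inj₂ (inj₁ _ , _ , z⟶xi)         = contradiction z⟶xi (same-part refl)
    ... | inj₂ (inj₂ (inj₁ y) , w⟶y , y⟶xi) =
      y , ∈⟦⟧⁺ (N₂? w) w⟶y , (λ i∈τ → asym (∈⟦⟧⁻ (τ? y) i∈τ) y⟶xi)
    ... | inj₂ (inj₂ (inj₂ _) , w⟶z , _)   = contradiction w⟶z (same-part refl)

    from-V1 : ∀ {w i} → i ∈ ⟦ N₁? w ⟧ → ∃[ y ] y ∉ ⟦ N₂? w ⟧ × i ∈ ⟦ τ? y ⟧
    from-V1 {w} {i} i∈N₁ with diam (x i) (v3 w) (λ ())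
    ... | inj₁ xi⟶w                        = contradiction xi⟶w (asym (∈⟦⟧⁻ (N₁? w) i∈N₁))
    ... | inj₂ (inj₁ _ , xi⟶z , _)         = contradiction xi⟶z (same-part refl)
    ... | inj₂ (inj₂ (inj₁ y) , xi⟶y , y⟶w) =
      y , (λ y∈N₂ → asym (∈⟦⟧⁻ (N₂? w) y∈N₂) y⟶w) , ∈⟦⟧⁺ (τ? y) xi⟶y
    ... | inj₂ (inj₂ (inj₂ _) , _ , z⟶w)   = contradiction z⟶w (same-part refl)

    antichain : ∀ {w w′} → ⟦ N₁? w ⟧ ⊆ ⟦ N₁? w′ ⟧ → ⟦ N₂? w ⟧ ⊆ ⟦ N₂? w′ ⟧ → w ≡ w′
    antichain {w} {w′} N₁⊆ N₂⊆ with w ≟ᶠ w′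
    ... | yes w≡w′ = w≡w′
    ... | no  w≢w′ with diam (v3 w) (v3 w′) (λ { refl → w≢w′ refl })
    ...   | inj₁ w⟶w′                          = contradiction w⟶w′ (same-part refl)
    ...   | inj₂ (inj₁ i , w⟶xi , xi⟶w′)       =
      contradiction xi⟶w′ (asym (∈⟦⟧⁻ (N₁? w′) (N₁⊆ (∈⟦⟧⁺ (N₁? w) w⟶xi))))
    ...   | inj₂ (inj₂ (inj₁ y) , w⟶y , y⟶w′)  =
      contradiction y⟶w′ (asym (∈⟦⟧⁻ (N₂? w′) (N₂⊆ (∈⟦⟧⁺ (N₂? w) w⟶y))))
    ...   | inj₂ (inj₂ (inj₂ _) , w⟶z , _)     = contradiction w⟶z (same-part refl)

  InV2⇒τ≡ : ∀ {A y} → InV2 D A y → Profile.τ profile y ≡ A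
  InV2⇒τ≡ {A} {y} (A⟶y , y⟶∁A) = ⊆-antisym τ⊆A (λ i∈A → ∈⟦⟧⁺ (τ? y) (A⟶y _ i∈A))
    where
    τ⊆A : ⟦ τ? y ⟧ ⊆ A
    τ⊆A {i} i∈τ with i ∈? A
    ... | yes i∈A = i∈A
    ... | no  i∉A = contradiction (y⟶∁A i i∉A) (asym (∈⟦⟧⁻ (τ? y) i∈τ))

-- Bounds on the size of V3

module Bounds {p q : ℕ} (R : Profile p q) where

  open Profile R

  ∋? : ∀ i → Decidable (λ w → i ∈ N₁ w)
  ∋? i w = i ∈? N₁ w

  ∌? : ∀ i → Decidable (λ w → i ∉ N₁ w)
  ∌? i = ∁? (∋? i)

  ∈every-τ⇒∈N₁ : ∀ {i w} → (∀ y → i ∈ τ y) → i ∈ N₁ w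
  ∈every-τ⇒∈N₁ {i} {w} i∈τ with i ∈? N₁ w
  ... | yes i∈N₁ = i∈N₁
  ... | no  i∉N₁ = let y , _ , i∉τ = to-V1 i∉N₁ in contradiction (i∈τ y) i∉τ

  ∉every-τ⇒∉N₁ : ∀ {i w} → (∀ y → i ∉ τ y) → i ∉ N₁ w
  ∉every-τ⇒∉N₁ i∉τ i∈N₁ = let y , _ , i∈τ = from-V1 i∈N₁ in i∉τ y i∈τ

  single-type : ∀ {T} → (∀ y → τ y ≡ T) → q ≤ central p
  single-type {T} τ≡T = sperner N₂ (antichain N₁⊆N₁)
    where
    N₁⊆N₁ : ∀ {w w′} → N₁ w ⊆ N₁ w′
    N₁⊆N₁ {x = i} i∈N₁ =
      let y , _ , i∈τy = from-V1 i∈N₁ in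
      ∈every-τ⇒∈N₁ (λ y′ → subst (i ∈_) (trans (τ≡T y) (sym (τ≡T y′))) i∈τy)

  #[_] : {C : Pred (Fin q) 0ℓ} → Decidable C → ℕ
  #[ C? ] = length (filter C? (allFin q))

  q≤#[C]+#[∁C] : ∀ {C : Pred (Fin q) 0ℓ} (C? : Decidable C) → q ≤ #[ C? ] + #[ ∁? C? ]
  q≤#[C]+#[∁C] C? =
    subst (_≤ #[ C? ] + #[ ∁? C? ]) (length-tabulate (λ w → w)) (length-split C? (allFin q))

  #[C]≤#[C∩D]+#[C∩∁D] : ∀ {C D : Pred (Fin q) 0ℓ} (C? : Decidable C) (D? : Decidable D) →
                         #[ C? ] ≤ #[ C? ∩? D? ] + #[ C? ∩? ∁? D? ]
  #[C]≤#[C∩D]+#[C∩∁D] C? D? = length-filter-split C? D? (allFin q)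

  module _ {C : Pred (Fin q) 0ℓ} (C? : Decidable C) where

    member : Fin #[ C? ] → Fin q
    member = lookup (filter C? (allFin q))

    member-injective : Injective _≡_ _≡_ member
    member-injective = lookup-injective (filter⁺ C? (allFin⁺ q))

    member-∈ : ∀ i → C (member i)
    member-∈ i = proj₂ (∈-filter⁻ C? {xs = allFin q} (∈-lookup i))

    class≤central : (S : Subset p) →
      (∀ {w w′} → C w → C w′ → N₁ w ⊆ N₁ w′) →
      (∀ {w w′ y} → C w → C w′ → y ∉ S → y ∈ N₂ w → y ∈ N₂ w′) →
      #[ C? ] ≤ central ∣ S ∣
    class≤central S same-N₁ nested-off-S = sperner (λ i → N₂ (member i) ↾ S) λ {i} {j} ↾⊆↾ →
      member-injective (antichain (same-N₁ (member-∈ i) (member-∈ j))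
                                  (⊆-from-↾ S ↾⊆↾ (nested-off-S (member-∈ i) (member-∈ j))))

    class≤1 : (∀ {w w′} → C w → C w′ → N₁ w ⊆ N₁ w′) → (∀ {w w′} → C w → C w′ → N₂ w ⊆ N₂ w′) →
              #[ C? ] ≤ 1
    class≤1 same-N₁ same-N₂ = subst (#[ C? ] ≤_) (cong central (∣⊥∣≡0 p))
      (class≤central ⊥ same-N₁ (λ C-w C-w′ _ → same-N₂ C-w C-w′))

    full-class≤1 : (∀ {w} → C w → ∀ i → i ∈ N₁ w) → #[ C? ] ≤ 1
    full-class≤1 full = class≤1 (λ _ C-w′ {i} _ → full C-w′ i) λ C-w _ y∈N₂ →
      let i , i∉N₁ , _ = from-V2 y∈N₂ in contradiction (full C-w i) i∉N₁

    empty-class≤1 : (∀ {w} → C w → ∀ i → i ∉ N₁ w) → #[ C? ] ≤ 1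
    empty-class≤1 empty = class≤1 (λ C-w _ {i} i∈N₁ → contradiction i∈N₁ (empty C-w i)) λ _ C-w′ _ →
      all-in-N₂ C-w′
      where
      all-in-N₂ : ∀ {w y} → C w → y ∈ N₂ w
      all-in-N₂ {w} {y} C-w with y ∈? N₂ w
      ... | yes y∈N₂ = y∈N₂
      ... | no  y∉N₂ = let i , i∈N₁ , _ = to-V2 y∉N₂ in contradiction i∈N₁ (empty C-w i)

  module Sides {A B : Subset 3} (types : ∀ y → τ y ≡ A ⊎ τ y ≡ B) where

    V₂ᴬ : Subset p
    V₂ᴬ = ⟦ (λ y → ≡-dec _≟ᵇ_ (τ y) A) ⟧

    ∈V₂ᴬ : ∀ {y} → y ∈ V₂ᴬ → τ y ≡ A
    ∈V₂ᴬ = ∈⟦⟧⁻ (λ y → ≡-dec _≟ᵇ_ (τ y) A)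

    ∉V₂ᴬ : ∀ {y} → y ∉ V₂ᴬ → τ y ≡ B
    ∉V₂ᴬ {y} y∉V₂ᴬ with types y
    ... | inj₁ τ≡A = contradiction (∈⟦⟧⁺ (λ y → ≡-dec _≟ᵇ_ (τ y) A) τ≡A) y∉V₂ᴬ
    ... | inj₂ τ≡B = τ≡B

    ∣V₂ᴬ∣+∣∁V₂ᴬ∣≡p : ∣ V₂ᴬ ∣ + ∣ ∁ V₂ᴬ ∣ ≡ p
    ∣V₂ᴬ∣+∣∁V₂ᴬ∣≡p = trans (cong (∣ V₂ᴬ ∣ +_) (∣∁p∣≡n∸∣p∣ V₂ᴬ)) (m+[n∸m]≡n (∣p∣≤n V₂ᴬ))

  module NestedTypes {a b c : Fin 3} (abc : Listing a b c) (a≢b : a ≢ b) (a≢c : a ≢ c) (b≢c : b ≢ c)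
                     (types : ∀ y → τ y ≡ ⁅ a ⁆ ⊎ τ y ≡ ∁ ⁅ c ⁆) where

    open Sides types

    a∈N₁ : ∀ {w} → a ∈ N₁ w
    a∈N₁ = ∈every-τ⇒∈N₁ λ y → [ (λ τ≡⁅a⁆ → subst (a ∈_) (sym τ≡⁅a⁆) (x∈⁅x⁆ a))
                              , (λ τ≡∁⁅c⁆ → subst (a ∈_) (sym τ≡∁⁅c⁆) (x≢y⇒x∈∁⁅y⁆ a≢c)) ]′ (types y)

    c∉N₁ : ∀ {w} → c ∉ N₁ w
    c∉N₁ = ∉every-τ⇒∉N₁ λ y → [ (λ τ≡⁅a⁆ c∈τ → a≢c (sym (x∈⁅y⁆⇒x≡y a (subst (c ∈_) τ≡⁅a⁆ c∈τ))))
                               , (λ τ≡∁⁅c⁆ c∈τ → x∈∁⁅y⁆⇒x≢y (subst (c ∈_) τ≡∁⁅c⁆ c∈τ) refl) ]′ (types y)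

    b∉N₁⇒ : ∀ {w} → b ∉ N₁ w → ∃[ y ] y ∈ V₂ᴬ × y ∈ N₂ w
    b∉N₁⇒ b∉N₁ with to-V1 b∉N₁
    ... | y , y∈N₂ , b∉τ with y ∈? V₂ᴬ
    ...   | yes y∈V₂ᴬ = y , y∈V₂ᴬ , y∈N₂
    ...   | no  y∉V₂ᴬ = contradiction (subst (b ∈_) (sym (∉V₂ᴬ y∉V₂ᴬ)) (x≢y⇒x∈∁⁅y⁆ b≢c)) b∉τ

    b∈N₁⇒ : ∀ {w} → b ∈ N₁ w → ∃[ y ] y ∉ V₂ᴬ × y ∉ N₂ w
    b∈N₁⇒ b∈N₁ with from-V1 b∈N₁
    ... | y , y∉N₂ , b∈τ =
      y , (λ y∈V₂ᴬ → a≢b (sym (x∈⁅y⁆⇒x≡y a (subst (b ∈_) (∈V₂ᴬ y∈V₂ᴬ) b∈τ)))) , y∉N₂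

    -- Listing V2ᴬ before x_b before V2ᴮ makes every final segment contradict b∉N₁⇒ or b∈N₁⇒.
    code : Fin q → Subset (∣ V₂ᴬ ∣ + suc ∣ ∁ V₂ᴬ ∣)
    code w = N₂ w ↾ V₂ᴬ ++ Vec.lookup (N₁ w) b ∷ N₂ w ↾ ∁ V₂ᴬ

    code-antichain : ∀ {w w′} → code w ⊆ code w′ → w ≡ w′
    code-antichain {w} {w′} code⊆ =
      let V₂ᴬ⊆ , b∷V₂ᴮ⊆ = ++-⊆⁻ (N₂ w ↾ V₂ᴬ) (N₂ w′ ↾ V₂ᴬ) code⊆ in
      antichain
        (⊆-by-listing abc (λ _ → a∈N₁)
                          (λ b∈N₁ → lookup⇒[]= b _ (head-⊆ b∷V₂ᴮ⊆ ([]=⇒lookup b∈N₁)))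
                          (λ c∈N₁ → contradiction c∈N₁ c∉N₁))
        (⊆-from-↾ V₂ᴬ V₂ᴬ⊆ (λ y∉V₂ᴬ → ↾-⊆ (drop-∷-⊆ b∷V₂ᴮ⊆) (x∉p⇒x∈∁p y∉V₂ᴬ)))

    code-not-final : ∀ w → ¬ FinalSegment (code w)
    code-not-final w fin with FinalSegment-++-∷ (N₂ w ↾ V₂ᴬ) (Vec.lookup (N₁ w) b) fin
    ... | inj₁ (b-bit≡outside , N₂↾V₂ᴬ≡⊥) =
      let y , y∈V₂ᴬ , y∈N₂ = b∉N₁⇒ λ b∈N₁ →
            contradiction (trans (sym ([]=⇒lookup b∈N₁)) b-bit≡outside) λ () in
      ∉⊥ (↾-⊆ (⊆-reflexive (trans N₂↾V₂ᴬ≡⊥ (sym (⊥↾S≡⊥ V₂ᴬ)))) y∈V₂ᴬ y∈N₂)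
    ... | inj₂ (b-bit≡inside , N₂↾V₂ᴮ≡⊤) =
      let y , y∉V₂ᴬ , y∉N₂ = b∈N₁⇒ (lookup⇒[]= b _ b-bit≡inside) in
      y∉N₂ (↾-⊆ (⊆-reflexive (trans (⊤↾S≡⊤ (∁ V₂ᴬ)) (sym N₂↾V₂ᴮ≡⊤))) (x∉p⇒x∈∁p y∉V₂ᴬ) ∈⊤)

    q<central[1+p] : q < central (suc p)
    q<central[1+p] = subst (λ n → q < central n)
      (trans (+-suc ∣ V₂ᴬ ∣ ∣ ∁ V₂ᴬ ∣) (cong suc ∣V₂ᴬ∣+∣∁V₂ᴬ∣≡p))
      (sperner-without-final-segments code code-antichain code-not-final)

  module ComplementaryTypes {a b c : Fin 3} (abc : Listing a b c) (acb : Listing a c b)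
                            (types : ∀ y → τ y ≡ ⁅ a ⁆ ⊎ τ y ≡ ∁ ⁅ a ⁆) where

    open Sides types

    ∁⁅a⁆-typed∉N₂ : ∀ {w y} → a ∈ N₁ w → τ y ≡ ∁ ⁅ a ⁆ → y ∉ N₂ w
    ∁⁅a⁆-typed∉N₂ {w} a∈N₁ τ≡∁⁅a⁆ y∈N₂ =
      let i , i∉N₁ , i∉τ = from-V2 y∈N₂ in
      i∉N₁ (subst (_∈ N₁ w) (sym (x∈⁅y⁆⇒x≡y a (x∉∁p⇒x∈p (subst (i ∉_) τ≡∁⁅a⁆ i∉τ)))) a∈N₁)

    ⁅a⁆-typed∈N₂ : ∀ {w y} → a ∉ N₁ w → τ y ≡ ⁅ a ⁆ → y ∈ N₂ w
    ⁅a⁆-typed∈N₂ {w} {y} a∉N₁ τ≡⁅a⁆ with y ∈? N₂ w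
    ... | yes y∈N₂ = y∈N₂
    ... | no  y∉N₂ =
      let i , i∈N₁ , i∈τ = to-V2 y∉N₂ in
      contradiction (subst (_∈ N₁ w) (x∈⁅y⁆⇒x≡y a (subst (i ∈_) τ≡⁅a⁆ i∈τ)) i∈N₁) a∉N₁

    module _ {β γ : Fin 3} (aβγ : Listing a β γ) {C : Pred (Fin q) 0ℓ} (C? : Decidable C) where

      class-aβ≤central : (∀ {w} → C w → a ∈ N₁ w × β ∈ N₁ w × γ ∉ N₁ w) → #[ C? ] ≤ central ∣ V₂ᴬ ∣
      class-aβ≤central shape = class≤central C? V₂ᴬ
        (λ C-w C-w′ → let _ , _ , γ∉N₁ = shape C-w ; a∈N₁′ , β∈N₁′ , _ = shape C-w′ in
          ⊆-by-listing aβγ (λ _ → a∈N₁′) (λ _ → β∈N₁′) (λ γ∈N₁ → contradiction γ∈N₁ γ∉N₁))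
        (λ C-w _ y∉V₂ᴬ y∈N₂ → contradiction y∈N₂ (∁⁅a⁆-typed∉N₂ (proj₁ (shape C-w)) (∉V₂ᴬ y∉V₂ᴬ)))

      class-β≤central : (∀ {w} → C w → a ∉ N₁ w × β ∈ N₁ w × γ ∉ N₁ w) → #[ C? ] ≤ central ∣ ∁ V₂ᴬ ∣
      class-β≤central shape = class≤central C? (∁ V₂ᴬ)
        (λ C-w C-w′ → let a∉N₁ , _ , γ∉N₁ = shape C-w ; _ , β∈N₁′ , _ = shape C-w′ in
          ⊆-by-listing aβγ (λ a∈N₁ → contradiction a∈N₁ a∉N₁) (λ _ → β∈N₁′)
                           (λ γ∈N₁ → contradiction γ∈N₁ γ∉N₁))
        (λ _ C-w′ y∉V₂ᴮ _ → ⁅a⁆-typed∈N₂ (proj₁ (shape C-w′)) (∈V₂ᴬ (x∉∁p⇒x∈p y∉V₂ᴮ)))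

    module _ (⁅a⁆-typed : ∃[ y ] τ y ≡ ⁅ a ⁆) (∁⁅a⁆-typed : ∃[ y ] τ y ≡ ∁ ⁅ a ⁆) where

      a∈∧β∉⇒γ∈ : ∀ {β γ w} → Listing a β γ → a ∈ N₁ w → β ∉ N₁ w → γ ∈ N₁ w
      a∈∧β∉⇒γ∈ aβγ a∈N₁ β∉N₁ with to-V2 (∁⁅a⁆-typed∉N₂ a∈N₁ (proj₂ ∁⁅a⁆-typed))
      ... | i , i∈N₁ , i∈τ with aβγ i
      ...   | inj₁ refl        = contradiction refl (x∈∁⁅y⁆⇒x≢y (subst (i ∈_) (proj₂ ∁⁅a⁆-typed) i∈τ))
      ...   | inj₂ (inj₁ refl) = contradiction i∈N₁ β∉N₁
      ...   | inj₂ (inj₂ refl) = i∈N₁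

      a∉∧β∈⇒γ∉ : ∀ {β γ w} → Listing a β γ → a ∉ N₁ w → β ∈ N₁ w → γ ∉ N₁ w
      a∉∧β∈⇒γ∉ aβγ a∉N₁ β∈N₁ γ∈N₁ with from-V2 (⁅a⁆-typed∈N₂ a∉N₁ (proj₂ ⁅a⁆-typed))
      ... | i , i∉N₁ , i∉τ with aβγ i
      ...   | inj₁ refl        = i∉τ (subst (a ∈_) (sym (proj₂ ⁅a⁆-typed)) (x∈⁅x⁆ a))
      ...   | inj₂ (inj₁ refl) = i∉N₁ β∈N₁
      ...   | inj₂ (inj₂ refl) = i∉N₁ γ∈N₁

      #∋a≤1+cA+cA : #[ ∋? a ] ≤ 1 + central ∣ V₂ᴬ ∣ + central ∣ V₂ᴬ ∣
      #∋a≤1+cA+cA = ≤-trans (#[C]≤#[C∩D]+#[C∩∁D] (∋? a) (∋? b)) (+-mono-≤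
        (≤-trans (#[C]≤#[C∩D]+#[C∩∁D] (∋? a ∩? ∋? b) (∋? c)) (+-mono-≤
          (full-class≤1 ((∋? a ∩? ∋? b) ∩? ∋? c) λ ((a∈ , b∈) , c∈) → ∈-by-listing abc a∈ b∈ c∈)
          (class-aβ≤central abc ((∋? a ∩? ∋? b) ∩? ∌? c) λ ((a∈ , b∈) , c∉) → a∈ , b∈ , c∉)))
        (class-aβ≤central acb (∋? a ∩? ∌? b) λ (a∈ , b∉) → a∈ , a∈∧β∉⇒γ∈ abc a∈ b∉ , b∉))

      #∌a≤cB+cB+1 : #[ ∌? a ] ≤ central ∣ ∁ V₂ᴬ ∣ + (central ∣ ∁ V₂ᴬ ∣ + 1)
      #∌a≤cB+cB+1 = ≤-trans (#[C]≤#[C∩D]+#[C∩∁D] (∌? a) (∋? b)) (+-mono-≤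
        (class-β≤central abc (∌? a ∩? ∋? b) λ (a∉ , b∈) → a∉ , b∈ , a∉∧β∈⇒γ∉ abc a∉ b∈)
        (≤-trans (#[C]≤#[C∩D]+#[C∩∁D] (∌? a ∩? ∌? b) (∋? c)) (+-mono-≤
          (class-β≤central acb ((∌? a ∩? ∌? b) ∩? ∋? c) λ ((a∉ , b∉) , c∈) → a∉ , c∈ , b∉)
          (empty-class≤1 ((∌? a ∩? ∌? b) ∩? ∌? c) λ ((a∉ , b∉) , c∉) → ∉-by-listing abc a∉ b∉ c∉))))

      q≤2+2*[cA+cB] : q ≤ 2 + 2 * (central ∣ V₂ᴬ ∣ + central ∣ ∁ V₂ᴬ ∣)
      q≤2+2*[cA+cB] = begin
        q                                ≤⟨ q≤#[C]+#[∁C] (∋? a) ⟩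
        #[ ∋? a ] + #[ ∌? a ]            ≤⟨ +-mono-≤ #∋a≤1+cA+cA #∌a≤cB+cB+1 ⟩
        (1 + cA + cA) + (cB + (cB + 1))  ≡⟨ solve 2 (λ x y → con 1 :+ x :+ x :+ (y :+ (y :+ con 1))
                                                   := con 2 :+ con 2 :* (x :+ y)) refl cA cB ⟩
        2 + 2 * (cA + cB)                ∎
        where
        open ≤-Reasoning
        open +-*-Solver
        cA cB : ℕ
        cA = central ∣ V₂ᴬ ∣
        cB = central ∣ ∁ V₂ᴬ ∣

    q≤bound : 2 ≤ p → q ≤ bound p
    q≤bound 2≤p with nonempty? V₂ᴬ | nonempty? (∁ V₂ᴬ)
    ... | no  ∄V₂ᴬ | _ =
      ≤-trans (single-type (λ y → ∉V₂ᴬ (λ y∈V₂ᴬ → ∄V₂ᴬ (y , y∈V₂ᴬ)))) (central≤bound 2≤p)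
    ... | yes _    | no ∄V₂ᴮ =
      ≤-trans (single-type (λ y → ∈V₂ᴬ (x∉∁p⇒x∈p (λ y∈V₂ᴮ → ∄V₂ᴮ (y , y∈V₂ᴮ))))) (central≤bound 2≤p)
    ... | yes (yᴬ , yᴬ∈V₂ᴬ) | yes (yᴮ , yᴮ∈V₂ᴮ) =
      subst (λ n → q ≤ bound n) ∣V₂ᴬ∣+∣∁V₂ᴬ∣≡p (≤-trans
        (q≤2+2*[cA+cB] (yᴬ , ∈V₂ᴬ yᴬ∈V₂ᴬ) (yᴮ , ∉V₂ᴬ (x∈∁p⇒x∉p yᴮ∈V₂ᴮ)))
        (two-sides≤bound ∣ V₂ᴬ ∣ ∣ ∁ V₂ᴬ ∣ (x∈p⇒1≤∣p∣ yᴬ∈V₂ᴬ) (x∈p⇒1≤∣p∣ yᴮ∈V₂ᴮ)))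

  types⇒q≤bound : ∀ {a c} → 2 ≤ p → (∀ y → τ y ≡ ⁅ a ⁆ ⊎ τ y ≡ ∁ ⁅ c ⁆) → q ≤ bound p
  types⇒q≤bound {a} {c} 2≤p types with a ≟ᶠ c
  ... | yes refl =
    let b , b′ , a≢b , a≢b′ , b≢b′ = others a in
    ComplementaryTypes.q≤bound (listing a≢b a≢b′ b≢b′) (listing a≢b′ a≢b (≢-sym b≢b′)) types 2≤p
  ... | no  a≢c  =
    let b , a≢b , b≢c = third a≢c in
    <central[1+p]⇒≤bound {p} (NestedTypes.q<central[1+p] (listing a≢b a≢c b≢c) a≢b a≢c b≢c types)

lemma4p6 : (p q : ℕ) → 3 ≤ p → p ≤ q →
    (D : Orientation p q) → Diameter2 D →
    (A B : Subset 3) → NonemptyProper A → NonemptyProper B → ¬ (∣ A ∣ ≡ ∣ B ∣) →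
    (∀ (y : Fin p) → InV2 D A y ⊎ InV2 D B y) →
    q ≤ ((4 + 2 * ((p ∸ 1) C ⌊ p ∸ 1 /2⌋)) ⊔ (2 + 4 * ((p ∸ 2) C ⌊ p ∸ 2 /2⌋)))
          ⊔ (((p + 1) C ⌊ p + 1 /2⌋) ∸ 1)
lemma4p6 p q 3≤p _ D (diam , _) A B A-np B-np ∣A∣≢∣B∣ typed
  with singleton-or-cosingleton A-np | singleton-or-cosingleton B-np
... | inj₁ (a , refl) | inj₁ (b , refl) = contradiction (trans (∣⁅x⁆∣≡1 a) (sym (∣⁅x⁆∣≡1 b))) ∣A∣≢∣B∣
... | inj₂ (a , refl) | inj₂ (b , refl) = contradiction (trans (∣∁⁅x⁆∣≡2 a) (sym (∣∁⁅x⁆∣≡2 b))) ∣A∣≢∣B∣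
... | inj₁ (a , refl) | inj₂ (c , refl) = Bounds.types⇒q≤bound (profile D diam) (≤-trans (n≤1+n 2) 3≤p)
  (map-⊎ (InV2⇒τ≡ D diam) (InV2⇒τ≡ D diam) ∘ typed)
... | inj₂ (c , refl) | inj₁ (a , refl) = Bounds.types⇒q≤bound (profile D diam) (≤-trans (n≤1+n 2) 3≤p)
  (swap ∘ map-⊎ (InV2⇒τ≡ D diam) (InV2⇒τ≡ D diam) ∘ typed)
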